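{- Let $\Delta_{m,\mathbf a}^{(\mathbf r)}(\mathbf x)=\sum_{i=1}^n a_iP_m^{(r_i)}(x_i)$ be a primitive shifted $m$-gonal form (variables in $\mathbb N_0$). (1) For every odd prime $p$ dividing $m-2$, $\Delta_{m,\mathbf a}^{(\mathbf r)}$ is $\mathbb Z_p$-universal. (2) If $m\not\equiv 0\pmod 4$, then $\Delta_{m,\mathbf a}^{(\mathbf r)}$ is $\mathbb Z_2$-universal.
   Context: For an integer $m\ge 3$ and a positive integer $r$ with $\gcd(r,m-2)=1$, the shifted $m$-gonal number of level $r$ is $P_m^{(r)}(x)=\frac{m-2}{2}x^2-\frac{m-2-2r}{2}x$ for $x\in\mathbb N_0$. A shifted $m$-gonal form is $\sum_{i=1}^n a_iP_m^{(r_i)}(x_i)$ with positive integers $a_i$, such levels $r_i$ and $x_i\in\mathbb N_0$; primitive means $\gcd(a_1,\dots,a_n)=1$. For a prime $p$, it is $\mathbb Z_p$-universal if $\sum a_iP_m^{(r_i)}(x_i)=N$ has a solution $\mathbf x\in\mathbb Z_p^n$ for every $N\in\mathbb Z_p$. -}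

module Defs where

open import Data.Nat as ℕ using (ℕ; zero; suc; _∸_)
open import Data.Nat.GCD using (gcd)
open import Data.Integer as ℤ using (ℤ; +_)
open import Data.Integer.Divisibility using () renaming (_∣_ to _∣ℤ_)
open import Data.Fin using (Fin; zero; suc)

sumℤ : (n : ℕ) → (Fin n → ℤ) → ℤ
sumℤ zero    f = + 0
sumℤ (suc n) f = f zero ℤ.+ sumℤ n (λ i → f (suc i))

gcdFin : (n : ℕ) → (Fin n → ℕ) → ℕ
gcdFin zero    a = 0
gcdFin (suc n) a = gcd (a zero) (gcdFin n (λ i → a (suc i)))

-- p-adic integers ℤ_p, modelled as p-adically Cauchy sequences of integers
-- with explicit modulus: x (k+1) ≡ x k (mod p^k).  Such a sequence
-- converges in ℤ_p to a unique limit ξ with ξ ≡ x k (mod p^k) for all k,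
-- and every element of ℤ_p arises this way.
record ℤ[_] (p : ℕ) : Set where
  field
    seq : ℕ → ℤ
    coh : ∀ k → (+ (p ℕ.^ k)) ∣ℤ (seq (suc k) ℤ.- seq k)
open ℤ[_] public

-- Twice the shifted m-gonal number of level r, as an integer polynomial:
-- 2 P_m^(r)(x) = (m-2) x^2 - (m-2-2r) x.
twiceP : ℕ → ℕ → ℤ → ℤ
twiceP m r x = (+ (m ∸ 2)) ℤ.* (x ℤ.* x) ℤ.- ((+ (m ∸ 2)) ℤ.- (+ (2 ℕ.* r))) ℤ.* x

-- Δ(x) = N holds in ℤ_p.  Since ℤ_p is an integral domain this is
-- equivalent to 2Δ(x) = 2N, which avoids dividing by 2.  Equality of the
-- limits of the sequences holds iff they agree modulo p^k at every level k.
SolvesIn : (p m n : ℕ) (a r : Fin n → ℕ) (N : ℤ[ p ]) (x : Fin n → ℤ[ p ]) → Set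
SolvesIn p m n a r N x =
  ∀ k → (+ (p ℕ.^ k)) ∣ℤ
          (sumℤ n (λ i → (+ a i) ℤ.* twiceP m (r i) (seq (x i) k))
             ℤ.- (+ 2) ℤ.* seq N k)

ℤₚ-universal : (p m n : ℕ) (a r : Fin n → ℕ) → Set
ℤₚ-universal p m n a r = (N : ℤ[ p ]) → Σ' (Fin n → ℤ[ p ]) (SolvesIn p m n a r N)
  where open import Data.Product using () renaming (Σ to Σ')

-- Only one variable is needed.  As the a_i are coprime, some a_i is a p-adic
-- unit; all other variables are set to 0.  A substitution x = s·y turns
-- a_i · 2P_m^(r_i)(x) into K · (c y² + b y) with p ∣ c and p ∤ b, and the Newton
-- iteration y ↦ y − u (c y² + b y − T), u b ≡ 1 (mod p), converges p-adically to a
-- root.  Writing M = m − 2: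
--   p odd, p ∣ M:     s = K = 1,      c = a M,    b = a (2r − M),  p ∤ 2r as p ≠ 2, gcd(r, M) = 1;
--   p = 2, M odd:     s = K = 2,      c = 2 a M,  b = a (2r − M);
--   p = 2, M = 4t:    s = 1, K = 2,   c = 2 a t,  b = a (r − 2t),  r odd.
-- The hypothesis m ≢ 0 (mod 4) rules out the remaining case M ≡ 2 (mod 4).

module Submission where

open import Defs
open import Data.Nat using (ℕ; _≤_; _∸_; _%_)
open import Data.Nat.Divisibility using (_∣_)
open import Data.Nat.GCD using (gcd)
open import Data.Nat.Primality using (Prime)
open import Data.Fin using (Fin)
open import Data.Product using (_×_)
open import Relation.Binary.PropositionalEquality using (_≡_; _≢_)

open import Data.Nat as ℕ using (zero; suc; _^_; _/_; s≤s)
open import Data.Nat.Properties using (m∸n+n≡m; <⇒≤; *-assoc)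
open import Data.Nat.Divisibility as ℕᵈ using (_∤_; _∣?_; n∣m⇒m%n≡0)
open import Data.Nat.DivMod using (m≡m%n+[m/n]*n; m%n<n)
open import Data.Nat.GCD using (gcd-greatest; module Bézout)
open import Data.Nat.Coprimality using (Coprime; coprime-Bézout)
open import Data.Nat.Primality using (euclidsLemma; prime⇒irreducible; prime⇒nonTrivial; prime[2])
import Data.Nat.Tactic.RingSolver as ℕ-Solver
open import Data.Integer as ℤ using (ℤ; +_; _+_; _*_; _-_; -_; 0ℤ; 1ℤ; ∣_∣)
open import Data.Integer.Properties
  using (pos-*; abs-*; *-zeroʳ; *-identityˡ; +-identityˡ; +-identityʳ; +∣i∣≡i⊎+∣i∣≡-i;
         neg-involutive; neg-distribˡ-*; neg-distribʳ-*)
open import Data.Integer.Divisibility.Signed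
  using (divides; ∣ᵤ⇒∣; ∣⇒∣ᵤ; ∣-refl; ∣-trans; *-monoˡ-∣; *-monoʳ-∣; ∣m⇒∣-m; ∣n⇒∣m*n; ∣m⇒∣m*n;
         ∣m∣n⇒∣m+n; ∣m∣n⇒∣m-n; ∣m+n∣n⇒∣m; ∣m+n∣m⇒∣n)
  renaming (_∣_ to _∣ℤ_)
import Data.Integer.Divisibility as ℤᵈ
open import Data.Integer.Tactic.RingSolver using (solve-∀)
open import Data.Fin using (zero; suc)
open import Data.Fin.Properties using (¬∀⟶∃¬)
open import Data.Product using (Σ; ∃; _,_)
open import Data.Sum as Sum using (_⊎_; inj₁; inj₂)
open import Data.Empty using (⊥-elim)
open import Function using (_∘_)
open import Relation.Nullary using (¬_; yes; no)
open import Relation.Binary.PropositionalEquality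
  using (refl; sym; trans; cong; cong₂; subst; subst₂; module ≡-Reasoning)

open ≡-Reasoning

prime∤1 : ∀ {p} → Prime p → p ∤ 1
prime∤1 pp p∣1 with ℕᵈ.∣1⇒≡1 p∣1 | prime⇒nonTrivial pp
... | refl | ()

prime∤⇒coprime : ∀ {p n} → Prime p → p ∤ n → Coprime p n
prime∤⇒coprime pp p∤n (d∣p , d∣n) with prime⇒irreducible pp d∣p
... | inj₁ d≡1 = d≡1
... | inj₂ refl = ⊥-elim (p∤n d∣n)

prime∤-of-gcd≡1 : ∀ {p r n} → Prime p → gcd r n ≡ 1 → p ∣ n → p ∤ r
prime∤-of-gcd≡1 pp gcd≡1 p∣n p∣r = prime∤1 pp (subst (_ ∣_) gcd≡1 (gcd-greatest p∣r p∣n))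

gcdFin-greatest : ∀ {d} n (a : Fin n → ℕ) → (∀ i → d ∣ a i) → d ∣ gcdFin n a
gcdFin-greatest zero    a d∣a = _ ℕᵈ.∣0
gcdFin-greatest (suc n) a d∣a = gcd-greatest (d∣a zero) (gcdFin-greatest n (a ∘ suc) (d∣a ∘ suc))

prime∤-coefficient : ∀ {p} n (a : Fin n → ℕ) → Prime p → gcdFin n a ≡ 1 → ∃ λ i → p ∤ a i
prime∤-coefficient n a pp gcd≡1 = ¬∀⟶∃¬ n _ (λ i → _ ∣? a i)
  (λ p∣a → prime∤1 pp (subst (_ ∣_) gcd≡1 (gcdFin-greatest n a p∣a)))

∣-*-∣ : ∀ {i j m n} → i ∣ℤ m → j ∣ℤ n → i * j ∣ℤ m * n
∣-*-∣ {j = j} {m = m} i∣m j∣n = ∣-trans (*-monoˡ-∣ j i∣m) (*-monoʳ-∣ m j∣n)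

∣m-n∣n⇒∣m : ∀ {i m n} → i ∣ℤ m - n → i ∣ℤ n → i ∣ℤ m
∣m-n∣n⇒∣m i∣m-n i∣n = ∣m+n∣n⇒∣m i∣m-n (∣m⇒∣-m i∣n)

∣m-n∣m⇒∣n : ∀ {i m n} → i ∣ℤ m - n → i ∣ℤ m → i ∣ℤ n
∣m-n∣m⇒∣n {n = n} i∣m-n i∣m = subst (_ ∣ℤ_) (neg-involutive n) (∣m⇒∣-m (∣m+n∣m⇒∣n i∣m-n i∣m))

euclidsLemmaℤ : ∀ i j {p} → Prime p → + p ∣ℤ i * j → + p ∣ℤ i ⊎ + p ∣ℤ j
euclidsLemmaℤ i j pp p∣ij =
  Sum.map ∣ᵤ⇒∣ ∣ᵤ⇒∣ (euclidsLemma ∣ i ∣ ∣ j ∣ pp (subst (_ ∣_) (abs-* i j) (∣⇒∣ᵤ p∣ij)))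

prime∤-* : ∀ {p i j} → Prime p → ¬ + p ∣ℤ i → ¬ + p ∣ℤ j → ¬ + p ∣ℤ i * j
prime∤-* {i = i} {j} pp p∤i p∤j p∣ij with euclidsLemmaℤ i j pp p∣ij
... | inj₁ p∣i = p∤i p∣i
... | inj₂ p∣j = p∤j p∣j

inverse-mod-prime-ℕ : ∀ {p n} → Prime p → p ∤ n → ∃ λ u → + p ∣ℤ 1ℤ - u * + n
inverse-mod-prime-ℕ {p} {n} pp p∤n with coprime-Bézout (prime∤⇒coprime pp p∤n)
... | Bézout.+- x y 1+yn≡xp = - + y , divides (+ x) (begin
      1ℤ - - + y * + n   ≡⟨ sub-neg (+ y) (+ n) ⟩
      1ℤ + + y * + n     ≡⟨ cong (λ t → 1ℤ + t) (pos-* y n) ⟨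
      + (1 ℕ.+ y ℕ.* n)  ≡⟨ cong +_ 1+yn≡xp ⟩
      + (x ℕ.* p)        ≡⟨ pos-* x p ⟩
      + x * + p          ∎)
  where
  sub-neg : ∀ u v → 1ℤ - - u * v ≡ 1ℤ + u * v
  sub-neg = solve-∀
... | Bézout.-+ x y 1+xp≡yn = + y , divides (- + x) (begin
      1ℤ - + y * + n           ≡⟨ cong (λ t → 1ℤ - t) (trans (sym (pos-* y n)) (cong +_ (sym 1+xp≡yn))) ⟩
      1ℤ - + (1 ℕ.+ x ℕ.* p)   ≡⟨ cong (λ t → 1ℤ - (1ℤ + t)) (pos-* x p) ⟩
      1ℤ - (1ℤ + + x * + p)    ≡⟨ cancel (+ x) (+ p) ⟩
      - + x * + p              ∎)
  where
  cancel : ∀ u v → 1ℤ - (1ℤ + u * v) ≡ - u * v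
  cancel = solve-∀

inverse-mod-prime : ∀ {p b} → Prime p → ¬ + p ∣ℤ b → ∃ λ u → + p ∣ℤ 1ℤ - u * b
inverse-mod-prime {p} {b} pp p∤b with inverse-mod-prime-ℕ pp (p∤b ∘ ∣ᵤ⇒∣) | +∣i∣≡i⊎+∣i∣≡-i b
... | u , p∣1-u∣b∣ | inj₁ ∣b∣≡b  = u , subst (λ t → + p ∣ℤ 1ℤ - u * t) ∣b∣≡b p∣1-u∣b∣
... | u , p∣1-u∣b∣ | inj₂ ∣b∣≡-b = - u , subst (λ t → + p ∣ℤ 1ℤ - t) u[-b]≡[-u]b
      (subst (λ t → + p ∣ℤ 1ℤ - u * t) ∣b∣≡-b p∣1-u∣b∣)
  where
  u[-b]≡[-u]b : u * - b ≡ - u * b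
  u[-b]≡[-u]b = trans (sym (neg-distribʳ-* u b)) (neg-distribˡ-* u b)

odd≡1+[/2]*2 : ∀ t → 2 ∤ t → t ≡ 1 ℕ.+ t / 2 ℕ.* 2
odd≡1+[/2]*2 t 2∤t with t % 2 | m≡m%n+[m/n]*n t 2 | m%n<n t 2
... | 0           | t≡[t/2]*2   | _ = ⊥-elim (2∤t (ℕᵈ.divides (t / 2) t≡[t/2]*2))
... | 1           | t≡1+[t/2]*2 | _ = t≡1+[t/2]*2
... | suc (suc _) | _           | s≤s (s≤s ())

odd-or-4∣ : ∀ M → (M ℕ.+ 2) % 4 ≢ 0 → 2 ∤ M ⊎ 4 ∣ M
odd-or-4∣ M M+2%4≢0 with 2 ∣? M
... | no 2∤M = inj₁ 2∤M
... | yes (ℕᵈ.divides t M≡2t) with 2 ∣? t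
...   | yes (ℕᵈ.divides s t≡2s) =
  inj₂ (ℕᵈ.divides s (trans M≡2t (trans (cong (ℕ._* 2) t≡2s) (*-assoc s 2 2))))
...   | no 2∤t = ⊥-elim (M+2%4≢0 (n∣m⇒m%n≡0 (M ℕ.+ 2) 4 (ℕᵈ.divides (t / 2 ℕ.+ 1) (begin
          M ℕ.+ 2                            ≡⟨ cong (ℕ._+ 2) M≡2t ⟩
          t ℕ.* 2 ℕ.+ 2                      ≡⟨ cong (λ x → x ℕ.* 2 ℕ.+ 2) (odd≡1+[/2]*2 t 2∤t) ⟩
          (1 ℕ.+ t / 2 ℕ.* 2) ℕ.* 2 ℕ.+ 2     ≡⟨ identity (t / 2) ⟩
          (t / 2 ℕ.+ 1) ℕ.* 4                ∎))))
  where
  identity : ∀ h → (1 ℕ.+ h ℕ.* 2) ℕ.* 2 ℕ.+ 2 ≡ (h ℕ.+ 1) ℕ.* 4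
  identity = ℕ-Solver.solve-∀

module _ {p : ℕ} where

  0ₚ : ℤ[ p ]
  seq 0ₚ k = 0ℤ
  coh 0ₚ k = _ ℕᵈ.∣0

  infixr 7 _·ₚ_
  _·ₚ_ : ℤ → ℤ[ p ] → ℤ[ p ]
  seq (s ·ₚ y) k = s * seq y k
  coh (s ·ₚ y) k = ∣⇒∣ᵤ (subst (+ (p ^ k) ∣ℤ_) (*-distribˡ-minus s (seq y (suc k)) (seq y k))
                                      (∣n⇒∣m*n s (∣ᵤ⇒∣ (coh y k))))
    where
    *-distribˡ-minus : ∀ s a b → s * (a - b) ≡ s * a - s * b
    *-distribˡ-minus = solve-∀

  single : ∀ {n} → Fin n → ℤ[ p ] → Fin n → ℤ[ p ]
  single zero    x zero    = x
  single zero    x (suc j) = 0ₚ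
  single (suc i) x zero    = 0ₚ
  single (suc i) x (suc j) = single i x j

  sumℤ-zero : ∀ n (g : Fin n → ℤ) → (∀ j → g j ≡ 0ℤ) → sumℤ n g ≡ 0ℤ
  sumℤ-zero zero    g g≡0 = refl
  sumℤ-zero (suc n) g g≡0 = cong₂ _+_ (g≡0 zero) (sumℤ-zero n (g ∘ suc) (g≡0 ∘ suc))

  sumℤ-single : ∀ {n} (f : Fin n → ℤ[ p ] → ℤ) (i : Fin n) (x : ℤ[ p ])
    → (∀ j → f j 0ₚ ≡ 0ℤ) → sumℤ n (λ j → f j (single i x j)) ≡ f i x
  sumℤ-single {suc n} f zero x f0≡0 = begin
    f zero x + sumℤ n (λ j → f (suc j) 0ₚ)  ≡⟨ cong (λ t → f zero x + t) (sumℤ-zero n _ (f0≡0 ∘ suc)) ⟩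
    f zero x + 0ℤ                           ≡⟨ +-identityʳ _ ⟩
    f zero x                                ∎
  sumℤ-single {suc n} f (suc i) x f0≡0 = begin
    f zero 0ₚ + sumℤ n (λ j → f (suc j) (single i x j))
      ≡⟨ cong₂ _+_ (f0≡0 zero) (sumℤ-single (f ∘ suc) i x (f0≡0 ∘ suc)) ⟩
    0ℤ + f (suc i) x                                      ≡⟨ +-identityˡ _ ⟩
    f (suc i) x                                           ∎

Represents : (p m : ℕ) (A : ℤ) (r : ℕ) (N x : ℤ[ p ]) → Set
Represents p m A r N x = ∀ k → + (p ^ k) ∣ℤ A * twiceP m r (seq x k) - + 2 * seq N k

twiceP-zero : ∀ m r → twiceP m r 0ℤ ≡ 0ℤ
twiceP-zero m r rewrite *-zeroʳ (+ (m ∸ 2)) | *-zeroʳ (+ (m ∸ 2) - + (2 ℕ.* r)) = refl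

universal-from-one-variable : ∀ {p m n} (a r : Fin n → ℕ) (i : Fin n)
  → ((N : ℤ[ p ]) → Σ ℤ[ p ] (Represents p m (+ a i) (r i) N))
  → ℤₚ-universal p m n a r
universal-from-one-variable {p} {m} {n} a r i represent N =
  let x , x-represents = represent N
  in single i x , λ k → ∣⇒∣ᵤ (subst (λ t → + (p ^ k) ∣ℤ t - + 2 * seq N k)
                                     (sym (sumℤ-single (term k) i x (term-0ₚ k)))
                                     (x-represents k))
  where
  term : ℕ → Fin n → ℤ[ p ] → ℤ
  term k j y = + a j * twiceP m (r j) (seq y k)
  term-0ₚ : ∀ k j → term k j 0ₚ ≡ 0ℤ
  term-0ₚ k j = trans (cong (λ t → + a j * t) (twiceP-zero m (r j))) (*-zeroʳ (+ a j))

quadratic : ℤ → ℤ → ℤ → ℤ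
quadratic c b y = c * y * y + b * y

newton-step : ∀ {p k c b u} y T → + p ∣ℤ c → + p ∣ℤ 1ℤ - u * b
  → + (p ^ k) ∣ℤ quadratic c b y - T
  → + (p ^ suc k) ∣ℤ quadratic c b (y - u * (quadratic c b y - T)) - T
-- With D the old error, the new one is (1 − u b − 2 u y c) D + c D · u² D: both terms
-- gain a factor p, the first from the slope, the second from c.
newton-step {p} {k} {c} {b} {u} y T p∣c p∣1-ub pᵏ∣error =
  subst₂ _∣ℤ_ (sym (pos-* p (p ^ k))) (sym (newton-error c b u y T))
    (∣m∣n⇒∣m+n (∣-*-∣ p∣slope pᵏ∣error) (∣m⇒∣m*n (u * u * (quadratic c b y - T)) (∣-*-∣ p∣c pᵏ∣error)))
  where
  newton-error : ∀ c b u y T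
    → c * (y - u * (c * y * y + b * y - T)) * (y - u * (c * y * y + b * y - T))
        + b * (y - u * (c * y * y + b * y - T)) - T
      ≡ ((1ℤ - u * b) - + 2 * u * y * c) * (c * y * y + b * y - T)
        + c * (c * y * y + b * y - T) * (u * u * (c * y * y + b * y - T))
  newton-error = solve-∀
  p∣slope : + p ∣ℤ (1ℤ - u * b) - + 2 * u * y * c
  p∣slope = ∣m∣n⇒∣m-n p∣1-ub (∣n⇒∣m*n (+ 2 * u * y) p∣c)

hensel : ∀ {p c b u} → + p ∣ℤ c → + p ∣ℤ 1ℤ - u * b → (T : ℤ[ p ])
  → Σ ℤ[ p ] λ y → ∀ k → + (p ^ k) ∣ℤ quadratic c b (seq y k) - seq T k
hensel {p} {c} {b} {u} p∣c p∣1-ub T = record { seq = approx ; coh = approx-coh } , approx-root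
  where
  approx : ℕ → ℤ
  approx-root : ∀ k → + (p ^ k) ∣ℤ quadratic c b (approx k) - seq T k
  next-error : ∀ k → + (p ^ k) ∣ℤ quadratic c b (approx k) - seq T (suc k)

  approx zero    = 0ℤ
  approx (suc k) = approx k - u * (quadratic c b (approx k) - seq T (suc k))

  approx-root zero    = ∣ᵤ⇒∣ (ℕᵈ.1∣ _)
  approx-root (suc k) =
    newton-step {p} {k} {c} {b} {u} (approx k) (seq T (suc k)) p∣c p∣1-ub (next-error k)

  next-error k = subst (_ ∣ℤ_) (shift (quadratic c b (approx k)) (seq T k) (seq T (suc k)))
                       (∣m∣n⇒∣m-n (approx-root k) (∣ᵤ⇒∣ (coh T k)))
    where
    shift : ∀ v s t → (v - s) - (t - s) ≡ v - t
    shift = solve-∀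

  approx-coh : ∀ k → + (p ^ k) ℤᵈ.∣ approx (suc k) - approx k
  approx-coh k =
    ∣⇒∣ᵤ (subst (_ ∣ℤ_) (sym (step (approx k) (u * (quadratic c b (approx k) - seq T (suc k)))))
                (∣m⇒∣-m (∣n⇒∣m*n u (next-error k))))
    where
    step : ∀ y w → (y - w) - y ≡ - w
    step = solve-∀

represents-via-quadratic : ∀ {p m r A c b} (s K : ℤ) → Prime p → + p ∣ℤ c → ¬ + p ∣ℤ b
  → (∀ y → A * twiceP m r (s * y) ≡ K * quadratic c b y)
  → (N T : ℤ[ p ]) → (∀ k → K * seq T k ≡ + 2 * seq N k)
  → Σ ℤ[ p ] (Represents p m A r N)
represents-via-quadratic {p} {m} {r} {A} {c} {b} s K pp p∣c p∤b substitute N T K·T≡2N =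
  let u , p∣1-ub = inverse-mod-prime pp p∤b
      y , y-root = hensel {c = c} {b} {u} p∣c p∣1-ub T
  in s ·ₚ y , λ k → subst (+ (p ^ k) ∣ℤ_) (sym (error≡ (seq y k) k)) (∣n⇒∣m*n K (y-root k))
  where
  error≡ : ∀ z k → A * twiceP m r (s * z) - + 2 * seq N k ≡ K * (quadratic c b z - seq T k)
  error≡ z k = begin
    A * twiceP m r (s * z) - + 2 * seq N k       ≡⟨ cong₂ _-_ (substitute z) (sym (K·T≡2N k)) ⟩
    K * quadratic c b z - K * seq T k            ≡⟨ distrib K (quadratic c b z) (seq T k) ⟨
    K * (quadratic c b z - seq T k)              ∎
    where
    distrib : ∀ s a b → s * (a - b) ≡ s * a - s * b
    distrib = solve-∀

twiceP-scaled : ∀ m r s A y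
  → A * twiceP m r (s * y) ≡ s * quadratic (s * A * + (m ∸ 2)) (A * (+ (2 ℕ.* r) - + (m ∸ 2))) y
twiceP-scaled m r s A y = identity s A (+ (m ∸ 2)) (+ (2 ℕ.* r)) y
  where
  identity : ∀ s A M R y
    → A * (M * ((s * y) * (s * y)) - (M - R) * (s * y)) ≡ s * ((s * A * M) * y * y + (A * (R - M)) * y)
  identity = solve-∀

twiceP-of-4∣ : ∀ {m} r t → m ∸ 2 ≡ t ℕ.* 4 → ∀ A y
  → A * twiceP m r (1ℤ * y) ≡ + 2 * quadratic (A * (+ t * + 2)) (A * (+ r - + t * + 2)) y
twiceP-of-4∣ r t M≡4t A y =
  subst₂ (λ M R → A * (M * ((1ℤ * y) * (1ℤ * y)) - (M - R) * (1ℤ * y))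
                       ≡ + 2 * quadratic (A * (+ t * + 2)) (A * (+ r - + t * + 2)) y)
         (trans (sym (pos-* t 4)) (cong +_ (sym M≡4t))) (sym (pos-* 2 r)) (identity A (+ t) (+ r) y)
  where
  identity : ∀ A T R y
    → A * ((T * + 4) * ((1ℤ * y) * (1ℤ * y)) - (T * + 4 - + 2 * R) * (1ℤ * y))
      ≡ + 2 * ((A * (T * + 2)) * y * y + (A * (R - T * + 2)) * y)
  identity = solve-∀

represents-at-odd-prime-divisor : ∀ {p m r A} → Prime p → p ≢ 2 → p ∣ m ∸ 2 → gcd r (m ∸ 2) ≡ 1 → p ∤ A
  → (N : ℤ[ p ]) → Σ ℤ[ p ] (Represents p m (+ A) r N)
represents-at-odd-prime-divisor {p} {m} {r} {A} pp p≢2 p∣M gcd≡1 p∤A N =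
  represents-via-quadratic {m = m} {r} {+ A} 1ℤ 1ℤ pp
    (∣n⇒∣m*n (1ℤ * + A) (∣ᵤ⇒∣ p∣M)) (prime∤-* {i = + A} pp (p∤A ∘ ∣⇒∣ᵤ) p∤2r-M)
    (twiceP-scaled m r 1ℤ (+ A)) N (+ 2 ·ₚ N) (λ k → *-identityˡ _)
  where
  p∤2r : p ∤ 2 ℕ.* r
  p∤2r p∣2r with euclidsLemma 2 r pp p∣2r
  ... | inj₂ p∣r = prime∤-of-gcd≡1 pp gcd≡1 p∣M p∣r
  ... | inj₁ p∣2 with prime⇒irreducible prime[2] p∣2
  ...   | inj₁ refl = prime∤1 pp ℕᵈ.∣-refl
  ...   | inj₂ p≡2  = p≢2 p≡2
  p∤2r-M : ¬ + p ∣ℤ + (2 ℕ.* r) - + (m ∸ 2)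
  p∤2r-M p∣2r-M = p∤2r (∣⇒∣ᵤ (∣m-n∣n⇒∣m {m = + (2 ℕ.* r)} {+ (m ∸ 2)} p∣2r-M (∣ᵤ⇒∣ p∣M)))

represents-at-2-of-odd : ∀ {m r A} → 2 ∤ m ∸ 2 → 2 ∤ A
  → (N : ℤ[ 2 ]) → Σ ℤ[ 2 ] (Represents 2 m (+ A) r N)
represents-at-2-of-odd {m} {r} {A} 2∤M 2∤A N =
  represents-via-quadratic {m = m} {r} {+ A} (+ 2) (+ 2) prime[2]
    (∣m⇒∣m*n (+ (m ∸ 2)) (∣m⇒∣m*n (+ A) ∣-refl)) (prime∤-* {i = + A} prime[2] (2∤A ∘ ∣⇒∣ᵤ) 2∤2r-M)
    (twiceP-scaled m r (+ 2) (+ A)) N N (λ _ → refl)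
  where
  2∤2r-M : ¬ + 2 ∣ℤ + (2 ℕ.* r) - + (m ∸ 2)
  2∤2r-M 2∣2r-M =
    2∤M (∣⇒∣ᵤ (∣m-n∣m⇒∣n {m = + (2 ℕ.* r)} {+ (m ∸ 2)} 2∣2r-M (∣ᵤ⇒∣ (ℕᵈ.m∣m*n r))))

represents-at-2-of-4∣ : ∀ {m r A} → 4 ∣ m ∸ 2 → gcd r (m ∸ 2) ≡ 1 → 2 ∤ A
  → (N : ℤ[ 2 ]) → Σ ℤ[ 2 ] (Represents 2 m (+ A) r N)
represents-at-2-of-4∣ {m} {r} {A} (ℕᵈ.divides t M≡4t) gcd≡1 2∤A N =
  represents-via-quadratic {m = m} {r} {+ A} 1ℤ (+ 2) prime[2]
    (∣n⇒∣m*n (+ A) 2∣2t) (prime∤-* {i = + A} prime[2] (2∤A ∘ ∣⇒∣ᵤ) 2∤r-2t)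
    (twiceP-of-4∣ {m} r t M≡4t (+ A)) N N (λ _ → refl)
  where
  2∣2t : + 2 ∣ℤ + t * + 2
  2∣2t = ∣n⇒∣m*n (+ t) ∣-refl
  2∤r : 2 ∤ r
  2∤r = prime∤-of-gcd≡1 prime[2] gcd≡1 (ℕᵈ.divides (t ℕ.* 2) (trans M≡4t (sym (*-assoc t 2 2))))
  2∤r-2t : ¬ + 2 ∣ℤ + r - + t * + 2
  2∤r-2t 2∣r-2t = 2∤r (∣⇒∣ᵤ (∣m-n∣n⇒∣m {m = + r} 2∣r-2t 2∣2t))

represents-at-2 : ∀ {m r A} → 2 ≤ m → m % 4 ≢ 0 → gcd r (m ∸ 2) ≡ 1 → 2 ∤ A
  → (N : ℤ[ 2 ]) → Σ ℤ[ 2 ] (Represents 2 m (+ A) r N)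
represents-at-2 {m} {r} 2≤m m%4≢0 gcd≡1 2∤A
  with odd-or-4∣ (m ∸ 2) (subst (λ x → x % 4 ≢ 0) (sym (m∸n+n≡m 2≤m)) m%4≢0)
... | inj₁ 2∤M = represents-at-2-of-odd {m} {r} 2∤M 2∤A
... | inj₂ 4∣M = represents-at-2-of-4∣ {m} {r} 4∣M gcd≡1 2∤A

universal-of-primitive : ∀ {p m n} (a r : Fin n → ℕ) → Prime p → gcdFin n a ≡ 1
  → (∀ i → p ∤ a i → (N : ℤ[ p ]) → Σ ℤ[ p ] (Represents p m (+ a i) (r i) N))
  → ℤₚ-universal p m n a r
universal-of-primitive {m = m} {n} a r pp gcd≡1 represent =
  let i , p∤aᵢ = prime∤-coefficient n a pp gcd≡1
  in universal-from-one-variable {m = m} a r i (represent i p∤aᵢ)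

proposition4p1 : (m n : ℕ) (a r : Fin n → ℕ)
    → 3 ≤ m
    → (∀ i → 1 ≤ a i)
    → (∀ i → 1 ≤ r i)
    → (∀ i → gcd (r i) (m ∸ 2) ≡ 1)
    → gcdFin n a ≡ 1
    → ((p : ℕ) → Prime p → p ≢ 2 → p ∣ (m ∸ 2) → ℤₚ-universal p m n a r)
      × (m % 4 ≢ 0 → ℤₚ-universal 2 m n a r)
proposition4p1 m n a r 3≤m _ _ r-coprime a-primitive =
    (λ p pp p≢2 p∣M → universal-of-primitive {m = m} a r pp a-primitive λ i p∤aᵢ →
       represents-at-odd-prime-divisor {m = m} {r i} pp p≢2 p∣M (r-coprime i) p∤aᵢ)
  , (λ m%4≢0 → universal-of-primitive {m = m} a r prime[2] a-primitive λ i 2∤aᵢ →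
       represents-at-2 {m} {r i} (<⇒≤ 3≤m) m%4≢0 (r-coprime i) 2∤aᵢ)
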